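{- For any integer $m \ge 8$, there is a numerical semigroup $S$ with multiplicity $m$, embedding dimension $4$, and $\eta(S) = 3$.
   Context: A numerical semigroup is a cofinite subset $S \subseteq \mathbb{Z}_{\ge 0}$ containing $0$ and closed under addition, with unique minimal generating set $n_1 < \cdots < n_e$; $e$ is the embedding dimension and $n_1$ the multiplicity. With $\varphi_S:\mathbb{Z}_{\ge 0}^e \to S$, $z \mapsto \sum z_in_i$, a presentation of $S$ is a subset of $\ker\varphi_S = \{(z,z') : \varphi_S(z) = \varphi_S(z')\}$ whose generated congruence is $\ker\varphi_S$; it is minimal if no proper subset is a presentation. All minimal presentations have the same cardinality, denoted $\eta(S)$. -}

module Defs where

open import Level using (Level)
open import Data.Nat using (ℕ; zero; suc; _+_; _*_; _≤_; _<_)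
open import Data.Fin using (Fin)
open import Data.Vec using (Vec; lookup; zipWith; sum)
open import Data.Product using (Σ; ∃; _×_; _,_)
open import Relation.Nullary using (¬_)
open import Relation.Binary.PropositionalEquality using (_≡_)
open import Function.Bundles using (_⇔_)

record NumericalSemigroup : Set₁ where
  field
    carrier  : ℕ → Set
    has-zero : carrier 0
    closed   : ∀ {a b} → carrier a → carrier b → carrier (a + b)
    cofinite : ∃ λ N → ∀ n → N ≤ n → carrier n
open NumericalSemigroup public

data Gen (A : ℕ → Set) : ℕ → Set where
  gen-zero : Gen A 0
  gen-elem : ∀ {a} → A a → Gen A a
  gen-add  : ∀ {a b} → Gen A a → Gen A b → Gen A (a + b)

Generates : NumericalSemigroup → (ℕ → Set) → Set
Generates S A = (∀ a → A a → carrier S a) × (∀ s → carrier S s → Gen A s)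

ProperSubset : {X : Set} → (X → Set) → (X → Set) → Set
ProperSubset {X} B A = (∀ x → B x → A x) × (∃ λ x → A x × ¬ B x)

IsMinimalGeneratingSet : NumericalSemigroup → (ℕ → Set) → Set₁
IsMinimalGeneratingSet S A =
  Generates S A × (∀ (B : ℕ → Set) → ProperSubset B A → ¬ Generates S B)

Image : {X : Set} {n : ℕ} → Vec X n → X → Set
Image {n = n} v x = ∃ λ (i : Fin n) → lookup v i ≡ x

StrictlyIncreasing : {n : ℕ} → Vec ℕ n → Set
StrictlyIncreasing {n} v = ∀ (i j : Fin n) → Data.Fin._<_ i j → lookup v i < lookup v j

φ : {e : ℕ} → Vec ℕ e → Vec ℕ e → ℕ
φ g z = sum (zipWith _*_ z g)

Pair : ℕ → Set
Pair e = Vec ℕ e × Vec ℕ e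

_⊕_ : {e : ℕ} → Vec ℕ e → Vec ℕ e → Vec ℕ e
u ⊕ v = zipWith _+_ u v

data Cong {e : ℕ} (ρ : Pair e → Set) : Vec ℕ e → Vec ℕ e → Set where
  c-base  : ∀ {a b} → ρ (a , b) → Cong ρ a b
  c-refl  : ∀ {a} → Cong ρ a a
  c-sym   : ∀ {a b} → Cong ρ a b → Cong ρ b a
  c-trans : ∀ {a b c} → Cong ρ a b → Cong ρ b c → Cong ρ a c
  c-add   : ∀ {a b} c → Cong ρ a b → Cong ρ (a ⊕ c) (b ⊕ c)

IsPresentation : {e : ℕ} → Vec ℕ e → (Pair e → Set) → Set
IsPresentation {e} g ρ =
  (∀ a b → ρ (a , b) → φ g a ≡ φ g b) ×
  (∀ a b → (φ g a ≡ φ g b) ⇔ Cong ρ a b)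

IsMinimalPresentation : {e : ℕ} → Vec ℕ e → (Pair e → Set) → Set₁
IsMinimalPresentation {e} g ρ =
  IsPresentation g ρ ×
  (∀ (P : Pair e → Set) → ProperSubset P ρ → ¬ IsPresentation g P)

-- η(S) = k, where g lists the minimal generators of S: some (hence every)
-- minimal presentation has exactly k elements, i.e. it is the image of an
-- injective map Fin k → ℕ^e × ℕ^e.
HasEta : {e : ℕ} → Vec ℕ e → ℕ → Set₁
HasEta {e} g k =
  Σ (Vec (Pair e) k) λ r →
    (∀ i j → lookup r i ≡ lookup r j → i ≡ j) ×
    IsMinimalPresentation g (Image r)

-- With d = m + 1, S = ⟨m, 4d, 5d, 6d⟩ is the gluing of ⟨m⟩ and d·⟨4, 5, 6⟩ along m·d, which needs
-- m ∈ ⟨4, 5, 6⟩ (true for m ≥ 8). Three relations present it: 3·4d = 2·6d and 2·5d = 4d + 6d from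
-- ⟨4, 5, 6⟩, and the gluing relation d·m = (a factorization of m by 4d, 5d, 6d). They rewrite every
-- factorization (x, y, z, w) into one with x ≤ m, y < 3, z < 2, and such a normal form is determined
-- by its value: x by coprimality of m and d, then (y, z) by 4y + 5z mod 6. The presentation is minimal
-- because for each relation some grading of ℕ⁴ respects the other two but not it.
module Submission where

open import Defs
open import Data.Nat using (ℕ; suc; _+_; _*_; _∸_; _≤_; _<_; z≤n; s≤s; NonZero; >-nonZero; _%_; _/_; _≤?_)
open import Data.Nat.Properties hiding (_≟_)
open import Data.Nat.DivMod using (m≡m%n+[m/n]*n; [m+kn]%n≡m%n; m%n<n; m<n⇒m%n≡m)
open import Data.Nat.Tactic.RingSolver using (solve-∀)
open import Data.Fin using (Fin; zero; suc)
open import Data.Fin.Properties using (_≟_)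
open import Data.Vec using (Vec; _∷_; []; lookup; map; replicate)
open import Data.Vec.Properties using (lookup-zipWith; lookup-map; lookup-replicate)
open import Data.Product using (Σ; ∃; _×_; _,_; proj₁; proj₂)
open import Data.Empty using (⊥-elim)
open import Function.Bundles using (Equivalence; mk⇔)
open import Relation.Binary.Bundles using (Setoid)
open import Relation.Nullary using (¬_; yes; no)
open import Relation.Binary.PropositionalEquality
  using (_≡_; _≢_; refl; sym; trans; cong; cong₂; subst; module ≡-Reasoning)
import Relation.Binary.Reasoning.Setoid as SetoidReasoning
open import Algebra.Properties.CommutativeSemigroup +-commutativeSemigroup using (x∙yz≈y∙xz)

private
  variable
    e : ℕ

zeros : Vec ℕ e
zeros = replicate _ 0

unit : Fin e → Vec ℕ e
unit zero    = 1 ∷ zeros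
unit (suc i) = 0 ∷ unit i

-- Scaling by q on the right, so that zero entries of a stay definitionally zero.
_⊛_ : ℕ → Vec ℕ e → Vec ℕ e
q ⊛ a = map (_* q) a

φ-⊕ : (g a b : Vec ℕ e) → φ g (a ⊕ b) ≡ φ g a + φ g b
φ-⊕ []      []      []      = refl
φ-⊕ (x ∷ g) (a ∷ as) (b ∷ bs) =
  trans (cong ((a + b) * x +_) (φ-⊕ g as bs)) (distrib a b x (φ g as) (φ g bs))
  where
  distrib : ∀ a b x p q → (a + b) * x + (p + q) ≡ (a * x + p) + (b * x + q)
  distrib = solve-∀

φ-zerosʳ : (g : Vec ℕ e) → φ g zeros ≡ 0
φ-zerosʳ []      = refl
φ-zerosʳ (_ ∷ g) = φ-zerosʳ g

φ-zerosˡ : (z : Vec ℕ e) → φ zeros z ≡ 0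
φ-zerosˡ []      = refl
φ-zerosˡ (a ∷ z) = cong₂ _+_ (*-zeroʳ a) (φ-zerosˡ z)

φ-unit : (g : Vec ℕ e) (i : Fin e) → φ g (unit i) ≡ lookup g i
φ-unit (x ∷ g) zero    = begin
  x + 0 + φ g zeros  ≡⟨ cong₂ _+_ (+-identityʳ x) (φ-zerosʳ g) ⟩
  x + 0              ≡⟨ +-identityʳ x ⟩
  x                  ∎
  where open ≡-Reasoning
φ-unit (_ ∷ g) (suc i) = φ-unit g i

φ-scale : ∀ k (g z : Vec ℕ e) → φ (map (k *_) g) z ≡ k * φ g z
φ-scale k []      []      = sym (*-zeroʳ k)
φ-scale k (x ∷ g) (a ∷ z) =
  trans (cong (a * (k * x) +_) (φ-scale k g z)) (factor a k x (φ g z))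
  where
  factor : ∀ a k x p → a * (k * x) + k * p ≡ k * (a * x + p)
  factor = solve-∀

lookup-unit-≢ : {i j : Fin e} → j ≢ i → lookup (unit j) i ≡ 0
lookup-unit-≢ {i = zero}  {zero}  j≢i = ⊥-elim (j≢i refl)
lookup-unit-≢ {i = suc i} {zero}  _   = lookup-replicate i 0
lookup-unit-≢ {i = zero}  {suc j} _   = refl
lookup-unit-≢ {i = suc i} {suc j} j≢i = lookup-unit-≢ (λ j≡i → j≢i (cong suc j≡i))

Factorization : Vec ℕ e → ℕ → Set
Factorization {e} g s = Σ (Vec ℕ e) λ z → φ g z ≡ s

factorization-+ : ∀ (g : Vec ℕ e) {a b} → Factorization g a → Factorization g b → Factorization g (a + b)
factorization-+ g (z , refl) (z′ , refl) = z ⊕ z′ , φ-⊕ g z z′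

factorization-generator : ∀ (g : Vec ℕ e) i → Factorization g (lookup g i)
factorization-generator g i = unit i , φ-unit g i

generatedSemigroup : (g : Vec ℕ e) → ∃ (λ N → ∀ n → N ≤ n → Factorization g n) → NumericalSemigroup
generatedSemigroup g cofinite-g = record
  { carrier  = Factorization g
  ; has-zero = zeros , φ-zerosʳ g
  ; closed   = factorization-+ g
  ; cofinite = cofinite-g
  }

module _ {A : ℕ → Set} where

  Gen-mono : ∀ {B : ℕ → Set} → (∀ a → A a → B a) → ∀ {s} → Gen A s → Gen B s
  Gen-mono A⊆B gen-zero        = gen-zero
  Gen-mono A⊆B (gen-elem a)    = gen-elem (A⊆B _ a)
  Gen-mono A⊆B (gen-add as bs) = gen-add (Gen-mono A⊆B as) (Gen-mono A⊆B bs)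

  Gen-multiple : ∀ k {a} → A a → Gen A (k * a)
  Gen-multiple 0       _ = gen-zero
  Gen-multiple (suc k) a = gen-add (gen-elem a) (Gen-multiple k a)

Gen-φ : (g z : Vec ℕ e) → Gen (Image g) (φ g z)
Gen-φ []      []      = gen-zero
Gen-φ (x ∷ g) (k ∷ z) =
  gen-add (Gen-multiple k (zero , refl)) (Gen-mono (λ { _ (i , gᵢ≡a) → suc i , gᵢ≡a }) (Gen-φ g z))

factorization-avoiding : ∀ (g : Vec ℕ e) i {B : ℕ → Set} →
  (∀ b → B b → ∃ λ j → j ≢ i × lookup g j ≡ b) →
  ∀ {s} → Gen B s → Σ (Vec ℕ e) λ z → φ g z ≡ s × lookup z i ≡ 0
factorization-avoiding g i B⊆g∖gᵢ gen-zero = zeros , φ-zerosʳ g , lookup-replicate i 0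
factorization-avoiding g i B⊆g∖gᵢ (gen-elem b) with B⊆g∖gᵢ _ b
... | j , j≢i , refl = unit j , φ-unit g j , lookup-unit-≢ j≢i
factorization-avoiding g i B⊆g∖gᵢ (gen-add bs bs′)
  with factorization-avoiding g i B⊆g∖gᵢ bs | factorization-avoiding g i B⊆g∖gᵢ bs′
... | z , refl , zᵢ≡0 | z′ , refl , z′ᵢ≡0 =
  z ⊕ z′ , φ-⊕ g z z′ , trans (lookup-zipWith _+_ i z z′) (cong₂ _+_ zᵢ≡0 z′ᵢ≡0)

isMinimalGeneratingSet-byIrredundance : ∀ (g : Vec ℕ e) cofinite-g →
  (∀ i z → lookup z i ≡ 0 → φ g z ≢ lookup g i) →
  IsMinimalGeneratingSet (generatedSemigroup g cofinite-g) (Image g)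
isMinimalGeneratingSet-byIrredundance g cofinite-g irredundant = generates , noProperSubsetGenerates
  where
  generates : Generates (generatedSemigroup g cofinite-g) (Image g)
  generates = (λ { _ (i , refl) → factorization-generator g i })
            , (λ { _ (z , refl) → Gen-φ g z })

  avoids : ∀ {B : ℕ → Set} {i} → (∀ b → B b → Image g b) → ¬ B (lookup g i) →
           ∀ b → B b → ∃ λ j → j ≢ i × lookup g j ≡ b
  avoids B⊆g gᵢ∉B b b∈B with B⊆g b b∈B
  ... | j , refl = j , (λ { refl → gᵢ∉B b∈B }) , refl

  noProperSubsetGenerates : ∀ B → ProperSubset B (Image g) → ¬ Generates (generatedSemigroup g cofinite-g) B
  noProperSubsetGenerates B (B⊆g , _ , (i , refl) , gᵢ∉B) (_ , S⊆⟨B⟩)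
    with factorization-avoiding g i (avoids B⊆g gᵢ∉B) (S⊆⟨B⟩ _ (factorization-generator g i))
  ... | z , φz≡gᵢ , zᵢ≡0 = irredundant i z zᵢ≡0 φz≡gᵢ

⊕-leftComm : (u v w : Vec ℕ e) → u ⊕ (v ⊕ w) ≡ v ⊕ (u ⊕ w)
⊕-leftComm []      []      []      = refl
⊕-leftComm (x ∷ u) (y ∷ v) (z ∷ w) = cong₂ _∷_ (x∙yz≈y∙xz x y z) (⊕-leftComm u v w)

0⊛-⊕ : (a c : Vec ℕ e) → (0 ⊛ a) ⊕ c ≡ c
0⊛-⊕ []      []      = refl
0⊛-⊕ (x ∷ a) (z ∷ c) = cong₂ _∷_ (cong (_+ z) (*-zeroʳ x)) (0⊛-⊕ a c)

suc⊛-⊕ : ∀ q (a c : Vec ℕ e) → (suc q ⊛ a) ⊕ c ≡ a ⊕ ((q ⊛ a) ⊕ c)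
suc⊛-⊕ q []      []      = refl
suc⊛-⊕ q (x ∷ a) (z ∷ c) =
  cong₂ _∷_ (trans (cong (_+ z) (*-suc x q)) (+-assoc x (x * q) z)) (suc⊛-⊕ q a c)

Balanced : Vec ℕ e → Pair e → Set
Balanced w (a , b) = φ w a ≡ φ w b

module _ {ρ : Pair e → Set} where

  Cong-setoid : Setoid _ _
  Cong-setoid = record
    { Carrier       = Vec ℕ e
    ; _≈_           = Cong ρ
    ; isEquivalence = record { refl = c-refl ; sym = c-sym ; trans = c-trans }
    }

  Cong-reflexive : ∀ {a b} → a ≡ b → Cong ρ a b
  Cong-reflexive refl = c-refl

  Cong-balanced : ∀ {w} → (∀ p → ρ p → Balanced w p) → ∀ {a b} → Cong ρ a b → Balanced w (a , b)
  Cong-balanced ρ-balanced (c-base ab)     = ρ-balanced _ ab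
  Cong-balanced ρ-balanced c-refl          = refl
  Cong-balanced ρ-balanced (c-sym ba)      = sym (Cong-balanced ρ-balanced ba)
  Cong-balanced ρ-balanced (c-trans ab bc) = trans (Cong-balanced ρ-balanced ab) (Cong-balanced ρ-balanced bc)
  Cong-balanced {w} ρ-balanced (c-add {a} {b} c ab) = begin
    φ w (a ⊕ c)    ≡⟨ φ-⊕ w a c ⟩
    φ w a + φ w c  ≡⟨ cong (_+ φ w c) (Cong-balanced ρ-balanced ab) ⟩
    φ w b + φ w c  ≡⟨ φ-⊕ w b c ⟨
    φ w (b ⊕ c)    ∎
    where open ≡-Reasoning

  Cong-iterate : ∀ {a b} → ρ (a , b) → ∀ q c → Cong ρ ((q ⊛ a) ⊕ c) ((q ⊛ b) ⊕ c)
  Cong-iterate {a} {b} ab 0       c = Cong-reflexive (trans (0⊛-⊕ a c) (sym (0⊛-⊕ b c)))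
  Cong-iterate {a} {b} ab (suc q) c = begin
    (suc q ⊛ a) ⊕ c    ≡⟨ suc⊛-⊕ q a c ⟩
    a ⊕ ((q ⊛ a) ⊕ c)  ≈⟨ c-add _ (c-base ab) ⟩
    b ⊕ ((q ⊛ a) ⊕ c)  ≡⟨ ⊕-leftComm b (q ⊛ a) c ⟩
    (q ⊛ a) ⊕ (b ⊕ c)  ≈⟨ Cong-iterate ab q (b ⊕ c) ⟩
    (q ⊛ b) ⊕ (b ⊕ c)  ≡⟨ ⊕-leftComm (q ⊛ b) b c ⟩
    b ⊕ ((q ⊛ b) ⊕ c)  ≡⟨ suc⊛-⊕ q b c ⟨
    (suc q ⊛ b) ⊕ c    ∎
    where open SetoidReasoning Cong-setoid

isPresentation-byNormalForms : ∀ (g : Vec ℕ e) {ρ : Pair e → Set} (Normal : Vec ℕ e → Set) →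
  (∀ p → ρ p → Balanced g p) →
  (∀ v → Σ (Vec ℕ e) λ v′ → Normal v′ × Cong ρ v v′) →
  (∀ {u v} → Normal u → Normal v → φ g u ≡ φ g v → u ≡ v) →
  IsPresentation g ρ
isPresentation-byNormalForms g {ρ} Normal ρ-balanced normalise normal-unique =
  (λ a b → ρ-balanced (a , b)) , λ a b → mk⇔ (complete a b) (Cong-balanced ρ-balanced)
  where
  complete : ∀ a b → φ g a ≡ φ g b → Cong ρ a b
  complete a b φa≡φb with normalise a | normalise b
  ... | a′ , a′-normal , a~a′ | b′ , b′-normal , b~b′ = begin
    a   ≈⟨ a~a′ ⟩
    a′  ≡⟨ normal-unique a′-normal b′-normal φa′≡φb′ ⟩
    b′  ≈⟨ b~b′ ⟨
    b   ∎
    where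
    open SetoidReasoning Cong-setoid
    φa′≡φb′ : φ g a′ ≡ φ g b′
    φa′≡φb′ = trans (sym (Cong-balanced ρ-balanced a~a′)) (trans φa≡φb (Cong-balanced ρ-balanced b~b′))

isMinimalPresentation-bySeparatingWeights : ∀ {k} (g : Vec ℕ e) (r : Vec (Pair e) k) →
  IsPresentation g (Image r) →
  (∀ i → Σ (Vec ℕ e) λ w → (∀ j → j ≢ i → Balanced w (lookup r j)) × ¬ Balanced w (lookup r i)) →
  IsMinimalPresentation g (Image r)
isMinimalPresentation-bySeparatingWeights g r r-presents separating =
  r-presents , noProperSubsetPresents
  where
  noProperSubsetPresents : ∀ P → ProperSubset P (Image r) → ¬ IsPresentation g P
  noProperSubsetPresents P (P⊆r , (a , b) , (i , refl) , rᵢ∉P) (_ , P-presents)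
    with separating i
  ... | w , others-balanced , rᵢ-unbalanced = rᵢ-unbalanced (Cong-balanced P-balanced a~b)
    where
    a~b : Cong P a b
    a~b = Equivalence.to (P-presents a b) (proj₁ r-presents a b (i , refl))

    P-balanced : ∀ p → P p → Balanced w p
    P-balanced p p∈P with P⊆r p p∈P
    ... | j , refl with j ≟ i
    ...   | yes refl = ⊥-elim (rᵢ∉P p∈P)
    ...   | no j≢i   = others-balanced j j≢i

m≡n*[m/n]+m%n : ∀ m n .{{_ : NonZero n}} → m ≡ n * (m / n) + m % n
m≡n*[m/n]+m%n m n = trans (m≡m%n+[m/n]*n m n) (trans (+-comm (m % n) _) (cong (_+ m % n) (*-comm (m / n) n)))

cofinite-fromResidues : ∀ {P : ℕ → Set} m .{{_ : NonZero m}} N →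
  (∀ {s} → P s → P (s + m)) → (∀ r → r < m → P (N + r)) → ∀ n → N ≤ n → P n
cofinite-fromResidues {P} m N step residue n N≤n =
  subst P N+k%m+k/m*m≡n (shift (k / m) (residue (k % m) (m%n<n k m)))
  where
  k : ℕ
  k = n ∸ N

  shift : ∀ q {s} → P s → P (s + q * m)
  shift 0       {s} p = subst P (sym (+-identityʳ s)) p
  shift (suc q) {s} p = subst P (+-assoc s m (q * m)) (shift q (step p))

  N+k%m+k/m*m≡n : N + k % m + k / m * m ≡ n
  N+k%m+k/m*m≡n = begin
    N + k % m + k / m * m    ≡⟨ +-assoc N (k % m) _ ⟩
    N + (k % m + k / m * m)  ≡⟨ cong (N +_) (m≡m%n+[m/n]*n k m) ⟨
    N + k                    ≡⟨ m+[n∸m]≡n N≤n ⟩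
    n                        ∎
    where open ≡-Reasoning

strictlyIncreasing-[_] : ∀ x → StrictlyIncreasing (x ∷ [])
strictlyIncreasing-[ x ] zero zero ()

strictlyIncreasing-∷ : ∀ {n x} {v : Vec ℕ (suc n)} →
  x < lookup v zero → StrictlyIncreasing v → StrictlyIncreasing (x ∷ v)
strictlyIncreasing-∷ x<v₀ v↑ zero    zero          ()
strictlyIncreasing-∷ x<v₀ v↑ zero    (suc zero)    _         = x<v₀
strictlyIncreasing-∷ x<v₀ v↑ zero    (suc (suc j)) _         = <-trans x<v₀ (v↑ zero (suc j) (s≤s z≤n))
strictlyIncreasing-∷ x<v₀ v↑ (suc i) (suc j)       (s≤s i<j) = v↑ i j i<j

g₄₅₆ : Vec ℕ 3
g₄₅₆ = 4 ∷ 5 ∷ 6 ∷ []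

g₄₅₆-factorization-≥8 : ∀ n → 8 ≤ n → Factorization g₄₅₆ n
g₄₅₆-factorization-≥8 n 8≤n = subst (Factorization g₄₅₆) (m+[n∸m]≡n 8≤n) (from8 (n ∸ 8))
  where
  from8 : ∀ k → Factorization g₄₅₆ (8 + k)
  from8 0 = (2 ∷ 0 ∷ 0 ∷ []) , refl
  from8 1 = (1 ∷ 1 ∷ 0 ∷ []) , refl
  from8 2 = (1 ∷ 0 ∷ 1 ∷ []) , refl
  from8 3 = (0 ∷ 1 ∷ 1 ∷ []) , refl
  from8 (suc (suc (suc (suc k)))) with from8 k
  ... | (y ∷ z ∷ w ∷ []) , φ≡8+k = (suc y ∷ z ∷ w ∷ []) , cong (4 +_) φ≡8+k

g₄₅₆-irredundant : ∀ i z → lookup z i ≡ 0 → φ g₄₅₆ z ≢ lookup g₄₅₆ i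
g₄₅₆-irredundant zero             (.0 ∷ 0     ∷ 0     ∷ []) refl ()
g₄₅₆-irredundant zero             (.0 ∷ 0     ∷ suc w ∷ []) refl ()
g₄₅₆-irredundant zero             (.0 ∷ suc z ∷ w     ∷ []) refl ()
g₄₅₆-irredundant (suc zero)       (0     ∷ .0 ∷ 0     ∷ []) refl ()
g₄₅₆-irredundant (suc zero)       (0     ∷ .0 ∷ suc w ∷ []) refl ()
g₄₅₆-irredundant (suc zero)       (1     ∷ .0 ∷ 0     ∷ []) refl ()
g₄₅₆-irredundant (suc zero)       (1     ∷ .0 ∷ suc w ∷ []) refl ()
g₄₅₆-irredundant (suc zero)       (suc (suc y) ∷ .0 ∷ w ∷ []) refl ()
g₄₅₆-irredundant (suc (suc zero)) (0     ∷ 0     ∷ .0 ∷ []) refl ()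
g₄₅₆-irredundant (suc (suc zero)) (0     ∷ 1     ∷ .0 ∷ []) refl ()
g₄₅₆-irredundant (suc (suc zero)) (0     ∷ suc (suc z) ∷ .0 ∷ []) refl ()
g₄₅₆-irredundant (suc (suc zero)) (1     ∷ 0     ∷ .0 ∷ []) refl ()
g₄₅₆-irredundant (suc (suc zero)) (1     ∷ suc z ∷ .0 ∷ []) refl ()
g₄₅₆-irredundant (suc (suc zero)) (suc (suc y) ∷ z ∷ .0 ∷ []) refl ()

g₄₅₆-<8 : ∀ i → lookup g₄₅₆ i < 8
g₄₅₆-<8 zero             = s≤s (s≤s (s≤s (s≤s (s≤s z≤n))))
g₄₅₆-<8 (suc zero)       = s≤s (s≤s (s≤s (s≤s (s≤s (s≤s z≤n)))))
g₄₅₆-<8 (suc (suc zero)) = s≤s (s≤s (s≤s (s≤s (s≤s (s≤s (s≤s z≤n))))))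

Normal₄₅₆ : Vec ℕ 3 → Set
Normal₄₅₆ (y ∷ z ∷ _ ∷ []) = y < 3 × z < 2

-- On normal forms, 4y + 5z takes the six values 0, 4, 8, 5, 9, 13, which are distinct mod 6.
residue₄₅₆⁻¹ : ℕ → ℕ × ℕ
residue₄₅₆⁻¹ 0 = 0 , 0
residue₄₅₆⁻¹ 1 = 2 , 1
residue₄₅₆⁻¹ 2 = 2 , 0
residue₄₅₆⁻¹ 3 = 1 , 1
residue₄₅₆⁻¹ 4 = 1 , 0
residue₄₅₆⁻¹ 5 = 0 , 1
residue₄₅₆⁻¹ _ = 0 , 0

residue₄₅₆⁻¹-correct : ∀ {y z} → y < 3 → z < 2 → residue₄₅₆⁻¹ ((y * 4 + z * 5) % 6) ≡ (y , z)
residue₄₅₆⁻¹-correct {0} {0} _ _ = refl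
residue₄₅₆⁻¹-correct {1} {0} _ _ = refl
residue₄₅₆⁻¹-correct {2} {0} _ _ = refl
residue₄₅₆⁻¹-correct {0} {1} _ _ = refl
residue₄₅₆⁻¹-correct {1} {1} _ _ = refl
residue₄₅₆⁻¹-correct {2} {1} _ _ = refl
residue₄₅₆⁻¹-correct {suc (suc (suc _))} (s≤s (s≤s (s≤s ()))) _
residue₄₅₆⁻¹-correct {_} {suc (suc _)}   _ (s≤s (s≤s ()))

φ-g₄₅₆ : ∀ y z w → φ g₄₅₆ (y ∷ z ∷ w ∷ []) ≡ (y * 4 + z * 5) + w * 6
φ-g₄₅₆ = regroup
  where
  regroup : ∀ y z w → y * 4 + (z * 5 + (w * 6 + 0)) ≡ (y * 4 + z * 5) + w * 6
  regroup = solve-∀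

residue₄₅₆-injective : ∀ {y z y′ z′} → y < 3 → z < 2 → y′ < 3 → z′ < 2 →
  (y * 4 + z * 5) % 6 ≡ (y′ * 4 + z′ * 5) % 6 → (y , z) ≡ (y′ , z′)
residue₄₅₆-injective y<3 z<2 y′<3 z′<2 residues≡ =
  trans (sym (residue₄₅₆⁻¹-correct y<3 z<2)) (trans (cong residue₄₅₆⁻¹ residues≡) (residue₄₅₆⁻¹-correct y′<3 z′<2))

g₄₅₆-normal-unique : ∀ {u v} → Normal₄₅₆ u → Normal₄₅₆ v → φ g₄₅₆ u ≡ φ g₄₅₆ v → u ≡ v
g₄₅₆-normal-unique {y ∷ z ∷ w ∷ []} {y′ ∷ z′ ∷ w′ ∷ []} (y<3 , z<2) (y′<3 , z′<2) φu≡φv =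
  last-determined (residue₄₅₆-injective y<3 z<2 y′<3 z′<2 residues≡) split≡
  where
  split≡ : (y * 4 + z * 5) + w * 6 ≡ (y′ * 4 + z′ * 5) + w′ * 6
  split≡ = trans (sym (φ-g₄₅₆ y z w)) (trans φu≡φv (φ-g₄₅₆ y′ z′ w′))

  residues≡ : (y * 4 + z * 5) % 6 ≡ (y′ * 4 + z′ * 5) % 6
  residues≡ = begin
    (y * 4 + z * 5) % 6                ≡⟨ [m+kn]%n≡m%n (y * 4 + z * 5) w 6 ⟨
    ((y * 4 + z * 5) + w * 6) % 6      ≡⟨ cong (_% 6) split≡ ⟩
    ((y′ * 4 + z′ * 5) + w′ * 6) % 6   ≡⟨ [m+kn]%n≡m%n (y′ * 4 + z′ * 5) w′ 6 ⟩
    (y′ * 4 + z′ * 5) % 6              ∎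
    where open ≡-Reasoning

  last-determined : ∀ {a b c a′ b′ c′} → (a , b) ≡ (a′ , b′) → (a * 4 + b * 5) + c * 6 ≡ (a′ * 4 + b′ * 5) + c′ * 6 →
                    (a ∷ b ∷ c ∷ []) ≡ (a′ ∷ b′ ∷ c′ ∷ [])
  last-determined {a} {b} {c} {c′ = c′} refl eq =
    cong (λ n → a ∷ b ∷ n ∷ []) (*-cancelʳ-≡ c c′ 6 (+-cancelˡ-≡ (a * 4 + b * 5) _ _ eq))

module Construction (m : ℕ) (8≤m : 8 ≤ m) where

  instance
    m-nonZero : NonZero m
    m-nonZero = >-nonZero (≤-trans (s≤s z≤n) 8≤m)

  d : ℕ
  d = suc m

  glued : ℕ → Vec ℕ 3 → Vec ℕ 4
  glued α h = α ∷ map (d *_) h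

  φ-glued : ∀ α h x u → φ (glued α h) (x ∷ u) ≡ x * α + d * φ h u
  φ-glued α h x u = cong (x * α +_) (φ-scale d h u)

  g : Vec ℕ 4
  g = glued m g₄₅₆

  g-increasing : StrictlyIncreasing g
  g-increasing =
    strictlyIncreasing-∷ (<-≤-trans (n<1+n m) (m≤m*n d 4))
      (strictlyIncreasing-∷ (*-monoʳ-< d (n<1+n 4))
        (strictlyIncreasing-∷ (*-monoʳ-< d (n<1+n 5)) strictlyIncreasing-[ d * 6 ]))

  -- Adding x + x′ to both sides exhibits x′ and x as the remainders of one number modulo d.
  glue-injective : ∀ {x x′ t t′} → x ≤ m → x′ ≤ m → x * m + d * t ≡ x′ * m + d * t′ → x ≡ x′ × t ≡ t′
  glue-injective {x} {x′} {t} {t′} x≤m x′≤m glue≡ = x≡x′ , t≡t′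
    where
    to-multiple : ∀ x t m → x + (x * m + suc m * t) ≡ (x + t) * suc m
    to-multiple = solve-∀

    multiples≡ : x′ + (x + t) * d ≡ x + (x′ + t′) * d
    multiples≡ = begin
      x′ + (x + t) * d              ≡⟨ cong (x′ +_) (to-multiple x t m) ⟨
      x′ + (x + (x * m + d * t))    ≡⟨ cong (λ n → x′ + (x + n)) glue≡ ⟩
      x′ + (x + (x′ * m + d * t′))  ≡⟨ x∙yz≈y∙xz x′ x _ ⟩
      x + (x′ + (x′ * m + d * t′))  ≡⟨ cong (x +_) (to-multiple x′ t′ m) ⟩
      x + (x′ + t′) * d             ∎
      where open ≡-Reasoning

    x≡x′ : x ≡ x′
    x≡x′ = begin
      x                        ≡⟨ m<n⇒m%n≡m (s≤s x≤m) ⟨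
      x % d                    ≡⟨ [m+kn]%n≡m%n x (x′ + t′) d ⟨
      (x + (x′ + t′) * d) % d  ≡⟨ cong (_% d) multiples≡ ⟨
      (x′ + (x + t) * d) % d   ≡⟨ [m+kn]%n≡m%n x′ (x + t) d ⟩
      x′ % d                   ≡⟨ m<n⇒m%n≡m (s≤s x′≤m) ⟩
      x′                       ∎
      where open ≡-Reasoning

    t≡t′ : t ≡ t′
    t≡t′ = *-cancelˡ-≡ t t′ d (+-cancelˡ-≡ (x * m) _ _ (trans glue≡ (cong (λ n → n * m + d * t′) (sym x≡x′))))

  x*m+d*t≡d*k⇒t≡k : ∀ x {t k} → k < m → x * m + d * t ≡ d * k → t ≡ k
  x*m+d*t≡d*k⇒t≡k x {t} {k} k<m glue≡ with x ≤? m
  ... | yes x≤m = proj₂ (glue-injective x≤m z≤n glue≡)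
  ... | no  x≰m = ⊥-elim (<-irrefl refl (begin-strict
    d * k           <⟨ *-monoʳ-< d k<m ⟩
    d * m           ≤⟨ *-monoˡ-≤ m (≰⇒> x≰m) ⟩
    x * m           ≤⟨ m≤m+n (x * m) (d * t) ⟩
    x * m + d * t   ≡⟨ glue≡ ⟩
    d * k           ∎))
    where open ≤-Reasoning

  d*t≢m : ∀ t → d * t ≢ m
  d*t≢m 0       d*0≡m = <-irrefl (trans (sym (*-zeroʳ d)) d*0≡m) (≤-trans (s≤s z≤n) 8≤m)
  d*t≢m (suc t) d*t≡m = <-irrefl (sym d*t≡m) (<-≤-trans (n<1+n m) (m≤m*n d (suc t)))

  g-irredundant : ∀ i z → lookup z i ≡ 0 → φ g z ≢ lookup g i
  g-irredundant zero    (.0 ∷ u) refl φz≡m = d*t≢m (φ g₄₅₆ u) (trans (sym (φ-glued m g₄₅₆ 0 u)) φz≡m)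
  g-irredundant (suc j) (x ∷ u) uⱼ≡0 φz≡gⱼ =
    g₄₅₆-irredundant j u uⱼ≡0
      (x*m+d*t≡d*k⇒t≡k x (<-≤-trans (g₄₅₆-<8 j) 8≤m)
        (trans (sym (φ-glued m g₄₅₆ x u)) (trans φz≡gⱼ (lookup-map j (d *_) g₄₅₆))))

  glue-factorization : ∀ x {t} → Factorization g₄₅₆ t → Factorization g (x * m + d * t)
  glue-factorization x (u , refl) = (x ∷ u) , φ-glued m g₄₅₆ x u

  -- For r < m, the element 2m² + m + r is (m - r) m + d (r + m), and r + m ≥ 8 lies in ⟨4, 5, 6⟩.
  g-residue : ∀ r → r < m → Factorization g (m * m + m * m + m + r)
  g-residue r r<m =
    subst (Factorization g) glue≡
      (glue-factorization (m ∸ r) (g₄₅₆-factorization-≥8 (r + m) (≤-trans 8≤m (m≤n+m m r))))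
    where
    j : ℕ
    j = m ∸ r

    r+j≡m : r + j ≡ m
    r+j≡m = m+[n∸m]≡n (<⇒≤ r<m)

    expand : ∀ r j → j * (r + j) + suc (r + j) * (r + (r + j)) ≡ (r + j) * (r + j) + (r + j) * (r + j) + (r + j) + r
    expand = solve-∀

    glue≡ : j * m + d * (r + m) ≡ m * m + m * m + m + r
    glue≡ = subst (λ n → j * n + suc n * (r + n) ≡ n * n + n * n + n + r) r+j≡m (expand r j)

  g-cofinite : ∃ λ N → ∀ n → N ≤ n → Factorization g n
  g-cofinite = m * m + m * m + m
             , cofinite-fromResidues m _ (λ p → factorization-+ g p (factorization-generator g zero)) g-residue

  m₄₅₆ : Vec ℕ 3
  m₄₅₆ = proj₁ (g₄₅₆-factorization-≥8 m 8≤m)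

  φm₄₅₆≡m : φ g₄₅₆ m₄₅₆ ≡ m
  φm₄₅₆≡m = proj₂ (g₄₅₆-factorization-≥8 m 8≤m)

  rel₁ rel₂ rel₃ : Pair 4
  rel₁ = (0 ∷ 3 ∷ 0 ∷ 0 ∷ []) , (0 ∷ 0 ∷ 0 ∷ 2 ∷ [])
  rel₂ = (0 ∷ 0 ∷ 2 ∷ 0 ∷ []) , (0 ∷ 1 ∷ 0 ∷ 1 ∷ [])
  rel₃ = (d ∷ 0 ∷ 0 ∷ 0 ∷ []) , (0 ∷ m₄₅₆)

  relations : Vec (Pair 4) 3
  relations = rel₁ ∷ rel₂ ∷ rel₃ ∷ []

  relations-injective : ∀ i j → lookup relations i ≡ lookup relations j → i ≡ j
  relations-injective zero             zero             _ = refl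
  relations-injective (suc zero)       (suc zero)       _ = refl
  relations-injective (suc (suc zero)) (suc (suc zero)) _ = refl
  relations-injective zero             (suc zero)       ()
  relations-injective zero             (suc (suc zero)) ()
  relations-injective (suc zero)       zero             ()
  relations-injective (suc zero)       (suc (suc zero)) ()
  relations-injective (suc (suc zero)) zero             ()
  relations-injective (suc (suc zero)) (suc zero)       ()

  ρ : Pair 4 → Set
  ρ = Image relations

  d*-≢ : ∀ {k k′} → k ≢ k′ → d * k ≢ d * k′
  d*-≢ k≢k′ dk≡dk′ = k≢k′ (*-cancelˡ-≡ _ _ d dk≡dk′)

  φ-glued-≡ : ∀ α h x u x′ u′ → Balanced (glued α h) ((x ∷ u) , (x′ ∷ u′)) → x * α + d * φ h u ≡ x′ * α + d * φ h u′
  φ-glued-≡ α h x u x′ u′ balanced = trans (sym (φ-glued α h x u)) (trans balanced (φ-glued α h x′ u′))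

  glued-balanced : ∀ α h x u x′ u′ → x * α + d * φ h u ≡ x′ * α + d * φ h u′ → Balanced (glued α h) ((x ∷ u) , (x′ ∷ u′))
  glued-balanced α h x u x′ u′ eq = trans (φ-glued α h x u) (trans eq (sym (φ-glued α h x′ u′)))

  rel₁-balanced : ∀ α h → φ h (3 ∷ 0 ∷ 0 ∷ []) ≡ φ h (0 ∷ 0 ∷ 2 ∷ []) → Balanced (glued α h) rel₁
  rel₁-balanced α h eq = glued-balanced α h 0 (3 ∷ 0 ∷ 0 ∷ []) 0 (0 ∷ 0 ∷ 2 ∷ []) (cong (d *_) eq)

  rel₂-balanced : ∀ α h → φ h (0 ∷ 2 ∷ 0 ∷ []) ≡ φ h (1 ∷ 0 ∷ 1 ∷ []) → Balanced (glued α h) rel₂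
  rel₂-balanced α h eq = glued-balanced α h 0 (0 ∷ 2 ∷ 0 ∷ []) 0 (1 ∷ 0 ∷ 1 ∷ []) (cong (d *_) eq)

  rel₃-balanced : ∀ α h → φ h m₄₅₆ ≡ α → Balanced (glued α h) rel₃
  rel₃-balanced α h φhm₄₅₆≡α = glued-balanced α h d zeros 0 m₄₅₆ (begin
    d * α + d * φ h zeros  ≡⟨ cong (λ n → d * α + d * n) (φ-zerosʳ h) ⟩
    d * α + d * 0          ≡⟨ cong (d * α +_) (*-zeroʳ d) ⟩
    d * α + 0              ≡⟨ +-identityʳ (d * α) ⟩
    d * α                  ≡⟨ cong (d *_) φhm₄₅₆≡α ⟨
    d * φ h m₄₅₆           ∎)
    where open ≡-Reasoning

  rel₁-unbalanced : ∀ α h → φ h (3 ∷ 0 ∷ 0 ∷ []) ≢ φ h (0 ∷ 0 ∷ 2 ∷ []) → ¬ Balanced (glued α h) rel₁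
  rel₁-unbalanced α h ne balanced = d*-≢ ne (φ-glued-≡ α h 0 (3 ∷ 0 ∷ 0 ∷ []) 0 (0 ∷ 0 ∷ 2 ∷ []) balanced)

  rel₂-unbalanced : ∀ α h → φ h (0 ∷ 2 ∷ 0 ∷ []) ≢ φ h (1 ∷ 0 ∷ 1 ∷ []) → ¬ Balanced (glued α h) rel₂
  rel₂-unbalanced α h ne balanced = d*-≢ ne (φ-glued-≡ α h 0 (0 ∷ 2 ∷ 0 ∷ []) 0 (1 ∷ 0 ∷ 1 ∷ []) balanced)

  relations-balanced : ∀ p → ρ p → Balanced g p
  relations-balanced _ (zero , refl)           = rel₁-balanced m g₄₅₆ refl
  relations-balanced _ (suc zero , refl)       = rel₂-balanced m g₄₅₆ refl
  relations-balanced _ (suc (suc zero) , refl) = rel₃-balanced m g₄₅₆ φm₄₅₆≡m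

  separating : ∀ i → Σ (Vec ℕ 4) λ w →
    (∀ j → j ≢ i → Balanced w (lookup relations j)) × ¬ Balanced w (lookup relations i)
  separating zero = glued (φ h₁ m₄₅₆) h₁
                  , (λ { zero 0≢0 → ⊥-elim (0≢0 refl)
                       ; (suc zero) _ → rel₂-balanced (φ h₁ m₄₅₆) h₁ refl
                       ; (suc (suc zero)) _ → rel₃-balanced (φ h₁ m₄₅₆) h₁ refl })
                  , rel₁-unbalanced (φ h₁ m₄₅₆) h₁ (λ ())
    where
    h₁ : Vec ℕ 3
    h₁ = 0 ∷ 1 ∷ 2 ∷ []
  separating (suc zero) = glued (φ h₂ m₄₅₆) h₂
                        , (λ { zero _ → rel₁-balanced (φ h₂ m₄₅₆) h₂ refl
                             ; (suc zero) 1≢1 → ⊥-elim (1≢1 refl)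
                             ; (suc (suc zero)) _ → rel₃-balanced (φ h₂ m₄₅₆) h₂ refl })
                        , rel₂-unbalanced (φ h₂ m₄₅₆) h₂ (λ ())
    where
    h₂ : Vec ℕ 3
    h₂ = 2 ∷ 0 ∷ 3 ∷ []
  separating (suc (suc zero)) = (1 ∷ zeros)
                              , (λ { zero _ → refl
                                   ; (suc zero) _ → refl
                                   ; (suc (suc zero)) 2≢2 → ⊥-elim (2≢2 refl) })
                              , λ balanced → 1+n≢0 (trans balanced (φ-zerosˡ m₄₅₆))

  Normal : Vec ℕ 4 → Set
  Normal (x ∷ u) = x ≤ m × Normal₄₅₆ u

  normalise₄₅₆ : ∀ x u → Σ (Vec ℕ 3) λ u′ → Normal₄₅₆ u′ × Cong ρ (x ∷ u) (x ∷ u′)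
  normalise₄₅₆ x (y ∷ z ∷ w ∷ []) =
    (y′ % 3 ∷ z % 2 ∷ 2 * (y′ / 3) + w′ ∷ []) , (m%n<n y′ 3 , m%n<n z 2) , (begin
      x ∷ y ∷ z ∷ w ∷ []                             ≡⟨ cong (λ n → x ∷ y ∷ n ∷ w ∷ []) (m≡n*[m/n]+m%n z 2) ⟩
      x ∷ y ∷ 2 * (z / 2) + z % 2 ∷ w ∷ []           ≈⟨ Cong-iterate (suc zero , refl) (z / 2) (x ∷ y ∷ z % 2 ∷ w ∷ []) ⟩
      x ∷ y′ ∷ z % 2 ∷ w′ ∷ []                       ≡⟨ cong (λ n → x ∷ n ∷ z % 2 ∷ w′ ∷ []) (m≡n*[m/n]+m%n y′ 3) ⟩
      x ∷ 3 * (y′ / 3) + y′ % 3 ∷ z % 2 ∷ w′ ∷ []    ≈⟨ Cong-iterate (zero , refl) (y′ / 3) (x ∷ y′ % 3 ∷ z % 2 ∷ w′ ∷ []) ⟩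
      x ∷ y′ % 3 ∷ z % 2 ∷ 2 * (y′ / 3) + w′ ∷ []    ∎)
    where
    open SetoidReasoning Cong-setoid
    y′ w′ : ℕ
    y′ = 1 * (z / 2) + y
    w′ = 1 * (z / 2) + w

  normalise : ∀ v → Σ (Vec ℕ 4) λ v′ → Normal v′ × Cong ρ v v′
  normalise (x ∷ u@(_ ∷ _ ∷ _ ∷ [])) = extend (normalise₄₅₆ (x % d) (((x / d) ⊛ m₄₅₆) ⊕ u))
    where
    extend : (Σ (Vec ℕ 3) λ u′ → Normal₄₅₆ u′ × Cong ρ (x % d ∷ ((x / d) ⊛ m₄₅₆) ⊕ u) (x % d ∷ u′)) →
             Σ (Vec ℕ 4) λ v′ → Normal v′ × Cong ρ (x ∷ u) v′
    extend (u′ , u′-normal , u₀~u′) = (x % d ∷ u′) , (≤-pred (m%n<n x d) , u′-normal) , (begin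
      x ∷ u                            ≡⟨ cong (_∷ u) (m≡n*[m/n]+m%n x d) ⟩
      d * (x / d) + x % d ∷ u          ≈⟨ Cong-iterate (suc (suc zero) , refl) (x / d) (x % d ∷ u) ⟩
      x % d ∷ ((x / d) ⊛ m₄₅₆) ⊕ u     ≈⟨ u₀~u′ ⟩
      x % d ∷ u′                       ∎)
      where open SetoidReasoning Cong-setoid

  normal-unique : ∀ {u v} → Normal u → Normal v → φ g u ≡ φ g v → u ≡ v
  normal-unique {x ∷ u} {x′ ∷ u′} (x≤m , u-normal) (x′≤m , u′-normal) φ≡
    with glue-injective x≤m x′≤m (φ-glued-≡ m g₄₅₆ x u x′ u′ φ≡)
  ... | refl , φu≡φu′ = cong (x ∷_) (g₄₅₆-normal-unique u-normal u′-normal φu≡φu′)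

  presentation : IsPresentation g ρ
  presentation = isPresentation-byNormalForms g Normal relations-balanced normalise normal-unique

proposition6p2 : ∀ (m : ℕ) → 8 ≤ m →
    Σ NumericalSemigroup λ S → Σ (Vec ℕ 4) λ g →
      StrictlyIncreasing g × IsMinimalGeneratingSet S (Image g) ×
      lookup g zero ≡ m × HasEta g 3
proposition6p2 m 8≤m =
  generatedSemigroup g g-cofinite , g , g-increasing ,
  isMinimalGeneratingSet-byIrredundance g g-cofinite g-irredundant , refl ,
  relations , relations-injective , isMinimalPresentation-bySeparatingWeights g relations presentation separating
  where open Construction m 8≤m
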